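{- The class $\mathsf{FIFD}$ of all Kripke frames $\langle W,\prec,\{D_w\}_{w\in W}\rangle$ such that $W$ is finite, $\prec$ is transitive and irreflexive, and every domain $D_w$ is finite, does not have the fixed-point property.
   Context: Language $\mathcal{L}$: countably many individual variables, Boolean constants $\top,\bot$, connectives $\neg,\to$, the quantifier $\forall$, the modal operator $\Box$, and countably many predicate symbols of each arity (no function symbols, constants or equality). Formulas: $\top$, $\bot$, $P(u_1,\ldots,u_n)$, closed under $\neg$, $\to$, $\forall u$, $\Box$; $\lor,\land,\leftrightarrow,\exists,\Diamond$ are the usual abbreviations. $\mathcal{L}'$ is $\mathcal{L}$ together with one fixed propositional variable $p$ (an additional atomic formula). For an $\mathcal{L}'$-formula $A(p)$ and an $\mathcal{L}$-formula $B$, $A(B)$ denotes the result of replacing every occurrence of $p$ by $B$. $A(p)$ is modalized in $p$ if every occurrence of $p$ lies within the scope of a $\Box$. Kripke frame: $\mathcal{F}=\langle W,\prec,\{D_w\}_{w\in W}\rangle$ with $W\neq\emptyset$, $\prec$ a binary relation on $W$, each $D_w$ nonempty and $D_w\subseteq D_{w'}$ whenever $w\prec w'$. An interpretation assigns to each world $w$ and $n$-ary predicate $P$ an $n$-ary relation on $D_w$. Truth of sentences with parameters from $D_w$ at $w$ is defined as usual: $\forall u A(u)$ is true at $w$ iff $A(a)$ is true at $w$ for all $a\in D_w$, and $\Box A$ is true at $w$ iff $A$ is true at every $v$ with $w\prec v$. A formula is valid in a frame $\mathcal{F}$ ($\mathcal{F}\models A$) if its universal closure is true at every world under every interpretation.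 A class $\mathsf{C}$ of frames has the fixed-point property if for every $\mathcal{L}'$-formula $A(p)$ modalized in $p$ there exists an $\mathcal{L}$-formula $B$ containing only predicate symbols occurring in $A$ such that $\mathcal{F}\models B\leftrightarrow A(B)$ for every $\mathcal{F}\in\mathsf{C}$. -}

module Defs where

open import Data.Nat using (ℕ; _<_; _≟_)
open import Data.Fin using (Fin)
open import Data.Vec using (Vec; []; _∷_; map)
open import Data.Bool using (Bool; T)
open import Data.Unit using (⊤; tt)
open import Data.Empty using (⊥)
open import Data.Product using (Σ; ∃; _×_; _,_)
open import Data.Sum using (_⊎_)
open import Relation.Nullary using (¬_; yes; no)
open import Relation.Binary.PropositionalEquality using (_≡_)

-- Fml X : formulas whose extra propositional atoms come from X.
--   Fml ⊥  is the language 𝓛,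
--   Fml ⊤  is 𝓛' = 𝓛 + one propositional variable p.

Var : Set
Var = ℕ

data Fml (X : Set) : Set where
  ⊤'   : Fml X
  ⊥'   : Fml X
  pred : (k i : ℕ) → Vec Var k → Fml X
  prop : X → Fml X
  ¬'_  : Fml X → Fml X
  _⇒_  : Fml X → Fml X → Fml X
  ∀'   : Var → Fml X → Fml X
  □_   : Fml X → Fml X

L : Set
L = Fml ⊥

L' : Set
L' = Fml ⊤

p : L'
p = prop tt

_∧'_ : ∀ {X} → Fml X → Fml X → Fml X
A ∧' B = ¬' (A ⇒ (¬' B))

_⇔_ : ∀ {X} → Fml X → Fml X → Fml X
A ⇔ B = (A ⇒ B) ∧' (B ⇒ A)

subst-p : L' → L → L
subst-p ⊤' B = ⊤'
subst-p ⊥' B = ⊥'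
subst-p (pred k i us) B = pred k i us
subst-p (prop _) B = B
subst-p (¬' A) B = ¬' subst-p A B
subst-p (A ⇒ A₁) B = subst-p A B ⇒ subst-p A₁ B
subst-p (∀' u A) B = ∀' u (subst-p A B)
subst-p (□ A) B = □ (subst-p A B)

Modalized : ∀ {X} → Fml X → Set
Modalized ⊤' = ⊤
Modalized ⊥' = ⊤
Modalized (pred k i us) = ⊤
Modalized (prop _) = ⊥
Modalized (¬' A) = Modalized A
Modalized (A ⇒ B) = Modalized A × Modalized B
Modalized (∀' u A) = Modalized A
Modalized (□ A) = ⊤

Occurs : ∀ {X} → ℕ → ℕ → Fml X → Set
Occurs k i ⊤' = ⊥
Occurs k i ⊥' = ⊥
Occurs k i (pred k' i' us) = (k ≡ k') × (i ≡ i')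
Occurs k i (prop _) = ⊥
Occurs k i (¬' A) = Occurs k i A
Occurs k i (A ⇒ B) = Occurs k i A ⊎ Occurs k i B
Occurs k i (∀' u A) = Occurs k i A
Occurs k i (□ A) = Occurs k i A

PredsIncluded : ∀ {X Y} → Fml X → Fml Y → Set
PredsIncluded B A = ∀ k i → Occurs k i B → Occurs k i A

-- W = Fin nW (finite), individuals of all domains are drawn from the
-- finite set Fin nI, D w is a (decidable) subset of Fin nI; the
-- accessibility relation is given by its characteristic function.

record FIFDFrame : Set where
  field
    nW        : ℕ
    nI        : ℕ
    W-nonempty : 0 < nW
    R         : Fin nW → Fin nW → Bool
    D         : Fin nW → Fin nI → Bool
    D-nonempty : ∀ w → ∃ λ a → T (D w a)
    D-mono    : ∀ w v a → T (R w v) → T (D w a) → T (D v a)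
    R-trans   : ∀ w v x → T (R w v) → T (R v x) → T (R w x)
    R-irrefl  : ∀ w → ¬ T (R w w)

Interp : FIFDFrame → Set
Interp F = Fin (FIFDFrame.nW F) → (k i : ℕ) → Vec (Fin (FIFDFrame.nI F)) k → Bool

Assign : FIFDFrame → Set
Assign F = Var → Fin (FIFDFrame.nI F)

update : ∀ {F} → Assign F → Var → Fin (FIFDFrame.nI F) → Assign F
update g u a v with v ≟ u
... | yes _ = a
... | no _ = g v

-- truth at a world (under an assignment whose values lie in D_w)
Sat : (F : FIFDFrame) → Interp F → Fin (FIFDFrame.nW F) → Assign F → L → Set
Sat F I w g ⊤' = ⊤
Sat F I w g ⊥' = ⊥
Sat F I w g (pred k i us) = T (I w k i (map g us))
Sat F I w g (prop ())
Sat F I w g (¬' A) = ¬ Sat F I w g A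
Sat F I w g (A ⇒ B) = Sat F I w g A → Sat F I w g B
Sat F I w g (∀' u A) =
  (a : Fin (FIFDFrame.nI F)) → T (FIFDFrame.D F w a) → Sat F I w (update {F} g u a) A
Sat F I w g (□ A) =
  (v : Fin (FIFDFrame.nW F)) → T (FIFDFrame.R F w v) → Sat F I v g A

-- validity: the universal closure is true at every world under every
-- interpretation, i.e. A holds at every w for every assignment into D_w
Valid : FIFDFrame → L → Set
Valid F A = (I : Interp F) (w : Fin (FIFDFrame.nW F)) (g : Assign F) →
  (∀ u → T (FIFDFrame.D F w (g u))) → Sat F I w g A

FIFD-FixedPointProperty : Set
FIFD-FixedPointProperty =
  (A : L') → Modalized A →
  Σ L λ B → PredsIncluded B A × ((F : FIFDFrame) → Valid F (B ⇔ subst-p A B))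

-- Take the chain of worlds n ≻ n−1 ≻ … ≻ 0 with D_w = {a ∣ w ≤ a}, and call
-- a − w, capped at 2, the age of a at w; let P¹₀ and P¹₁ hold of the
-- individuals of age 0 and 1.  Truth of a formula whose □-nesting is k only
-- depends on the ages of its variables and on the current world capped at 2k
-- (a back-and-forth argument).  For A(p) = ∀x (P¹₀x → □(P¹₁x → ¬p)) and a
-- candidate fixed point B, take worlds c+1 ≻ c above that threshold and x of
-- age 1: there A(B) says precisely that B fails at c, whereas B cannot tell
-- (c+1, x) from (c, x of age 1) — so B ↔ ¬B.
module Submission where

open import Defs
open import Data.Bool using (Bool; false; T)
open import Data.Fin using (Fin; toℕ; fromℕ<)
open import Data.Fin.Properties using (toℕ<n; toℕ-fromℕ<)
open import Data.Nat using (ℕ; zero; suc; _+_; _∸_; _≤_; _<_; z≤n; s≤s; _⊔_; _<ᵇ_; _≤ᵇ_; _≡ᵇ_; _≟_; _≤?_)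
open import Data.Nat.Properties
open import Data.Product using (Σ; _×_; _,_; proj₁; proj₂)
open import Data.Sum using (_⊎_; inj₁; inj₂)
open import Data.Unit using (tt)
open import Data.Vec using (Vec; []; _∷_; map)
open import Data.Vec.Properties using (map-∘; map-cong)
open import Function using (_∘_; const)
open import Relation.Nullary using (¬_; yes; no)
open import Relation.Binary.PropositionalEquality
  using (_≡_; refl; sym; trans; cong; subst; module ≡-Reasoning)

cap : ℕ → ℕ
cap zero = 0
cap (suc zero) = 1
cap (suc (suc _)) = 2

cap-idem : ∀ x → cap (cap x) ≡ cap x
cap-idem zero = refl
cap-idem (suc zero) = refl
cap-idem (suc (suc x)) = refl

cap≤2 : ∀ x → cap x ≤ 2
cap≤2 zero = z≤n
cap≤2 (suc zero) = s≤s z≤n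
cap≤2 (suc (suc x)) = ≤-refl

cap≡1⇒≡1 : ∀ {x} → cap x ≡ 1 → x ≡ 1
cap≡1⇒≡1 {suc zero} _ = refl

cap-+-cap : ∀ x k → cap (x + k) ≡ cap (cap x + k)
cap-+-cap zero k = refl
cap-+-cap (suc zero) k = refl
cap-+-cap (suc (suc x)) k = refl

cap-+-≥2 : ∀ x {k} → 2 ≤ k → cap (x + k) ≡ 2
cap-+-≥2 zero (s≤s (s≤s _)) = refl
cap-+-≥2 (suc zero) (s≤s (s≤s _)) = refl
cap-+-≥2 (suc (suc x)) _ = refl

AgreeUpTo : ℕ → ℕ → ℕ → Set
AgreeUpTo d m n = m ≡ n ⊎ (d ≤ m × d ≤ n)

AgreeUpTo-sym : ∀ {d m n} → AgreeUpTo d m n → AgreeUpTo d n m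
AgreeUpTo-sym (inj₁ m≡n) = inj₁ (sym m≡n)
AgreeUpTo-sym (inj₂ (d≤m , d≤n)) = inj₂ (d≤n , d≤m)

AgreeUpTo-mono : ∀ {d e m n} → e ≤ d → AgreeUpTo d m n → AgreeUpTo e m n
AgreeUpTo-mono e≤d (inj₁ m≡n) = inj₁ m≡n
AgreeUpTo-mono e≤d (inj₂ (d≤m , d≤n)) = inj₂ (≤-trans e≤d d≤m , ≤-trans e≤d d≤n)

cap-+-agree : ∀ x {k k'} → AgreeUpTo 2 k k' → cap (x + k) ≡ cap (x + k')
cap-+-agree x (inj₁ refl) = refl
cap-+-agree x (inj₂ (2≤k , 2≤k')) = trans (cap-+-≥2 x 2≤k) (sym (cap-+-≥2 x 2≤k'))

∸-split : ∀ {v h a} → v ≤ h → h ≤ a → a ∸ v ≡ (a ∸ h) + (h ∸ v)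
∸-split {v} {h} {a} v≤h h≤a = begin
  a ∸ v            ≡⟨ cong (_∸ v) (sym (m∸n+n≡m h≤a)) ⟩
  (a ∸ h) + h ∸ v  ≡⟨ +-∸-assoc (a ∸ h) v≤h ⟩
  (a ∸ h) + (h ∸ v) ∎
  where open ≡-Reasoning

2≤2+m∸n : ∀ {m n} → n ≤ m → 2 ≤ suc (suc m) ∸ n
2≤2+m∸n {m} {n} n≤m = ≤-trans (m≤m+n 2 (m ∸ n)) (≤-reflexive (sym (+-∸-assoc 2 n≤m)))

-- Descending from h to v adds h ∸ v to every age, and capped ages only see
-- whether that step is 1 or at least 2.
pick-successor : ∀ d {h h' v'} → AgreeUpTo (2 + d) h h' → v' < h' →
  Σ ℕ λ v → v < h × AgreeUpTo 2 (h ∸ v) (h' ∸ v') × AgreeUpTo d v v'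
pick-successor d {v' = v'} (inj₁ refl) v'<h' = v' , v'<h' , inj₁ refl , inj₁ refl
pick-successor d {suc (suc a)} {suc (suc b)} {v'} (inj₂ (s≤s (s≤s d≤a) , s≤s (s≤s d≤b))) v'<h'
  with m<1+n⇒m<n∨m≡n v'<h'
... | inj₂ refl =
  suc a , n<1+n (suc a) , inj₁ (trans (m+n∸n≡m 1 a) (sym (m+n∸n≡m 1 b))) ,
  inj₂ (m≤n⇒m≤1+n d≤a , m≤n⇒m≤1+n d≤b)
... | inj₁ v'<1+b with v' ≤? a
...   | yes v'≤a =
  v' , s≤s (m≤n⇒m≤1+n v'≤a) , inj₂ (2≤2+m∸n v'≤a , 2≤2+m∸n (≤-pred v'<1+b)) , inj₁ refl
...   | no v'≰a =
  a , s≤s (n≤1+n a) , inj₂ (2≤2+m∸n {a} ≤-refl , 2≤2+m∸n (≤-pred v'<1+b)) ,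
  inj₂ (d≤a , ≤-trans d≤a (<⇒≤ (≰⇒> v'≰a)))

-- □ counts twice: answering a step may need one of length 2 (pick-successor).
depth : L → ℕ
depth ⊤' = 0
depth ⊥' = 0
depth (pred k i us) = 0
depth (prop ())
depth (¬' A) = depth A
depth (A ⇒ B) = depth A ⊔ depth B
depth (∀' u A) = depth A
depth (□ A) = 2 + depth A

module AgeModel (n : ℕ) (J : (k i : ℕ) → Vec ℕ k → Bool) where

  W : Set
  W = Fin (suc n)

  E : Set
  E = Fin (3 + n)

  oldest : E
  oldest = fromℕ< {2 + n} ≤-refl

  oldest-in-every-domain : (w : W) → toℕ w ≤ toℕ oldest
  oldest-in-every-domain w rewrite toℕ-fromℕ< {2 + n} {3 + n} ≤-refl =
    ≤-trans (≤-pred (toℕ<n w)) (m≤n+m n 2)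

  frame : FIFDFrame
  frame = record
    { nW = suc n
    ; nI = 3 + n
    ; W-nonempty = s≤s z≤n
    ; R = λ w v → toℕ v <ᵇ toℕ w
    ; D = λ w a → toℕ w ≤ᵇ toℕ a
    ; D-nonempty = λ w → oldest , ≤⇒≤ᵇ (oldest-in-every-domain w)
    ; D-mono = λ w v a v≺w a∈w →
        ≤⇒≤ᵇ (≤-trans (<⇒≤ (<ᵇ⇒< (toℕ v) (toℕ w) v≺w)) (≤ᵇ⇒≤ (toℕ w) (toℕ a) a∈w))
    ; R-trans = λ w v x v≺w x≺v → <⇒<ᵇ (<-trans (<ᵇ⇒< (toℕ x) (toℕ v) x≺v) (<ᵇ⇒< (toℕ v) (toℕ w) v≺w))
    ; R-irrefl = λ w w≺w → <-irrefl refl (<ᵇ⇒< (toℕ w) (toℕ w) w≺w)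
    }

  age : W → E → ℕ
  age w a = cap (toℕ a ∸ toℕ w)

  interp : Interp frame
  interp w k i as = J k i (map (age w) as)

  Holds : W → Assign frame → L → Set
  Holds = Sat frame interp

  _[_↦_] : Assign frame → Var → E → Assign frame
  g [ u ↦ a ] = update {frame} g u a

  InDomain : W → Assign frame → Set
  InDomain w g = ∀ u → toℕ w ≤ toℕ (g u)

  InDomain-≤ : ∀ {v w g} → toℕ v ≤ toℕ w → InDomain w g → InDomain v g
  InDomain-≤ v≤w dom u = ≤-trans v≤w (dom u)

  update-InDomain : ∀ {w g a} u → toℕ w ≤ toℕ a → InDomain w g → InDomain w (g [ u ↦ a ])
  update-InDomain u a∈w dom v with v ≟ u
  ... | yes _ = a∈w
  ... | no _ = dom v

  record AgesAgree (h : W) (g : Assign frame) (h' : W) (g' : Assign frame) : Set where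
    constructor ages-agree
    field age-≡ : ∀ u → age h (g u) ≡ age h' (g' u)
  open AgesAgree

  update-AgesAgree : ∀ {h g h' g' a a'} u → age h a ≡ age h' a' →
    AgesAgree h g h' g' → AgesAgree h (g [ u ↦ a ]) h' (g' [ u ↦ a' ])
  update-AgesAgree {h} {g} {h'} {g'} {a} {a'} u a≈a' agree = ages-agree ages
    where
    ages : ∀ v → age h ((g [ u ↦ a ]) v) ≡ age h' ((g' [ u ↦ a' ]) v)
    ages v with v ≟ u
    ... | yes _ = a≈a'
    ... | no _ = age-≡ agree v

  Bisim : ℕ → W → Assign frame → W → Assign frame → Set
  Bisim d h g h' g' = AgesAgree h g h' g' × AgreeUpTo d (toℕ h) (toℕ h')

  Bisim-sym : ∀ {d h g h' g'} → Bisim d h g h' g' → Bisim d h' g' h g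
  Bisim-sym (agree , level) = ages-agree (λ u → sym (age-≡ agree u)) , AgreeUpTo-sym level

  Bisim-mono : ∀ {d e h g h' g'} → e ≤ d → Bisim d h g h' g' → Bisim e h g h' g'
  Bisim-mono e≤d (agree , level) = agree , AgreeUpTo-mono e≤d level

  age-below : ∀ {v h a} → toℕ v ≤ toℕ h → toℕ h ≤ toℕ a →
    age v a ≡ cap (age h a + (toℕ h ∸ toℕ v))
  age-below {v} {h} {a} v≤h h≤a =
    trans (cong cap (∸-split v≤h h≤a)) (cap-+-cap (toℕ a ∸ toℕ h) (toℕ h ∸ toℕ v))

  age≡0∧age≡1⇒adjacent : ∀ {v h a} → toℕ v ≤ toℕ h → toℕ h ≤ toℕ a →
    age h a ≡ 0 → age v a ≡ 1 → toℕ h ≡ suc (toℕ v)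
  age≡0∧age≡1⇒adjacent {v} {h} {a} v≤h h≤a age₀ age₁ = begin
    toℕ h                    ≡⟨ sym (m∸n+n≡m v≤h) ⟩
    (toℕ h ∸ toℕ v) + toℕ v  ≡⟨ cong (_+ toℕ v) (cap≡1⇒≡1 distance) ⟩
    suc (toℕ v)              ∎
    where
    open ≡-Reasoning
    distance : cap (toℕ h ∸ toℕ v) ≡ 1
    distance = trans (cong (λ x → cap (x + (toℕ h ∸ toℕ v))) (sym age₀))
                     (trans (sym (age-below v≤h h≤a)) age₁)

  element-of-age : (h : W) (k : ℕ) → Σ E λ a → toℕ h ≤ toℕ a × age h a ≡ cap k
  element-of-age h k = fromℕ< bound , in-domain , aged
    where
    bound : cap k + toℕ h < 3 + n
    bound = s≤s (+-mono-≤ (cap≤2 k) (≤-pred (toℕ<n h)))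
    in-domain : toℕ h ≤ toℕ (fromℕ< bound)
    in-domain rewrite toℕ-fromℕ< bound = m≤n+m (toℕ h) (cap k)
    aged : age h (fromℕ< bound) ≡ cap k
    aged rewrite toℕ-fromℕ< bound | m+n∸n≡m (cap k) (toℕ h) = cap-idem k

  matching-successor : ∀ {d h g h' g' v'} → InDomain h g → InDomain h' g' →
    Bisim (2 + d) h g h' g' → toℕ v' < toℕ h' → Σ W λ v → toℕ v < toℕ h × Bisim d v g v' g'
  matching-successor {d} {h} {g} {h'} {g'} {v'} dom dom' (agree , level) v'<h'
    with pick-successor d level v'<h'
  ... | m , m<h , distance , level'
    with fromℕ< (<-trans m<h (toℕ<n h)) | toℕ-fromℕ< (<-trans m<h (toℕ<n h))
  ... | v | refl = v , m<h , ages , level'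
    where
    open ≡-Reasoning
    ages : AgesAgree v g v' g'
    age-≡ ages u = begin
      age v (g u)                             ≡⟨ age-below (<⇒≤ m<h) (dom u) ⟩
      cap (age h (g u) + (toℕ h ∸ toℕ v))     ≡⟨ cong (λ x → cap (x + (toℕ h ∸ toℕ v))) (age-≡ agree u) ⟩
      cap (age h' (g' u) + (toℕ h ∸ toℕ v))   ≡⟨ cap-+-agree (age h' (g' u)) distance ⟩
      cap (age h' (g' u) + (toℕ h' ∸ toℕ v')) ≡⟨ sym (age-below (<⇒≤ v'<h') (dom' u)) ⟩
      age v' (g' u)                           ∎

  transfer : ∀ φ {h g h' g'} → InDomain h g → InDomain h' g' →
    Bisim (depth φ) h g h' g' → Holds h g φ → Holds h' g' φ
  transfer ⊤' dom dom' bisim holds = tt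
  transfer ⊥' dom dom' bisim ()
  transfer (pred k i us) {h} {g} {h'} {g'} dom dom' (agree , _) holds =
    subst (T ∘ J k i) ages holds
    where
    open ≡-Reasoning
    ages : map (age h) (map g us) ≡ map (age h') (map g' us)
    ages = begin
      map (age h) (map g us)   ≡⟨ sym (map-∘ (age h) g us) ⟩
      map (age h ∘ g) us       ≡⟨ map-cong (age-≡ agree) us ⟩
      map (age h' ∘ g') us     ≡⟨ map-∘ (age h') g' us ⟩
      map (age h') (map g' us) ∎
  transfer (prop ()) dom dom' bisim holds
  transfer (¬' A) dom dom' bisim holds holds' =
    holds (transfer A dom' dom (Bisim-sym bisim) holds')
  transfer (A ⇒ B) dom dom' bisim holds holdsA =
    transfer B dom dom' (Bisim-mono (m≤n⊔m (depth A) (depth B)) bisim)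
      (holds (transfer A dom' dom (Bisim-sym (Bisim-mono (m≤m⊔n (depth A) (depth B)) bisim)) holdsA))
  transfer (∀' u A) {h} {g} {h'} {g'} dom dom' (agree , level) holds a' a'∈h' =
    let (a , a∈h , aged) = element-of-age h (toℕ a' ∸ toℕ h')
    in transfer A (update-InDomain u a∈h dom) (update-InDomain u (≤ᵇ⇒≤ _ _ a'∈h') dom')
         (update-AgesAgree u aged agree , level) (holds a (≤⇒≤ᵇ a∈h))
  transfer (□ A) dom dom' bisim holds v' v'≺h' =
    let v'<h' = <ᵇ⇒< _ _ v'≺h'
        (v , v<h , bisim-v) = matching-successor dom dom' bisim v'<h'
    in transfer A (InDomain-≤ (<⇒≤ v<h) dom) (InDomain-≤ (<⇒≤ v'<h') dom') bisim-v
         (holds v (<⇒<ᵇ v<h))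

ageInterp : (k i : ℕ) → Vec ℕ k → Bool
ageInterp 1 i (x ∷ []) = i ≡ᵇ x
ageInterp _ _ _ = false

unfixable : L'
unfixable = ∀' 0 (pred 1 0 (0 ∷ []) ⇒ (□ (pred 1 1 (0 ∷ []) ⇒ (¬' p))))

module Counterexample (B : L) where

  c : ℕ
  c = depth B

  open AgeModel (suc c) ageInterp

  w₀ w₁ : W
  w₀ = fromℕ< (s≤s (n≤1+n c))
  w₁ = fromℕ< (n<1+n (suc c))

  toℕ-w₀ : toℕ w₀ ≡ c
  toℕ-w₀ = toℕ-fromℕ< (s≤s (n≤1+n c))

  w₁≡1+w₀ : toℕ w₁ ≡ suc (toℕ w₀)
  w₁≡1+w₀ = trans (toℕ-fromℕ< (n<1+n (suc c))) (cong suc (sym toℕ-w₀))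

  w₀≤w₁ : toℕ w₀ ≤ toℕ w₁
  w₀≤w₁ = ≤-trans (n≤1+n (toℕ w₀)) (≤-reflexive (sym w₁≡1+w₀))

  aged : ℕ → E
  aged k = proj₁ (element-of-age w₁ k)

  aged-∈ : ∀ k → toℕ w₁ ≤ toℕ (aged k)
  aged-∈ k = proj₁ (proj₂ (element-of-age w₁ k))

  age-aged₁ : ∀ k → age w₁ (aged k) ≡ cap k
  age-aged₁ k = proj₂ (proj₂ (element-of-age w₁ k))

  age-aged₀ : ∀ k → age w₀ (aged k) ≡ cap (cap k + 1)
  age-aged₀ k = begin
    age w₀ (aged k)                             ≡⟨ age-below w₀≤w₁ (aged-∈ k) ⟩
    cap (age w₁ (aged k) + (toℕ w₁ ∸ toℕ w₀))   ≡⟨ cong (λ x → cap (age w₁ (aged k) + (x ∸ toℕ w₀))) w₁≡1+w₀ ⟩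
    cap (age w₁ (aged k) + (1 + toℕ w₀ ∸ toℕ w₀)) ≡⟨ cong (λ x → cap (age w₁ (aged k) + x)) (m+n∸n≡m 1 (toℕ w₀)) ⟩
    cap (age w₁ (aged k) + 1)                   ≡⟨ cong (λ x → cap (x + 1)) (age-aged₁ k) ⟩
    cap (cap k + 1)                             ∎
    where open ≡-Reasoning

  old g₀ g₁ : Assign frame
  old = const (aged 2)
  g₀ = old [ 0 ↦ aged 0 ]
  g₁ = old [ 0 ↦ aged 1 ]

  dom₁ : InDomain w₁ g₁
  dom₁ = update-InDomain 0 (aged-∈ 1) (λ _ → aged-∈ 2)

  dom₀ : InDomain w₀ g₀
  dom₀ = InDomain-≤ w₀≤w₁ (update-InDomain 0 (aged-∈ 0) (λ _ → aged-∈ 2))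

  g₁-old-at-w₀ : ∀ u → age w₀ (g₁ u) ≡ 2
  g₁-old-at-w₀ u with u ≟ 0
  ... | yes _ = age-aged₀ 1
  ... | no _ = age-aged₀ 2

  bisim₁₀ : Bisim c w₁ g₁ w₀ g₀
  bisim₁₀ =
    update-AgesAgree 0 (trans (age-aged₁ 1) (sym (age-aged₀ 0)))
      (ages-agree λ _ → trans (age-aged₁ 2) (sym (age-aged₀ 2))) ,
    inj₂ (≤-trans c≤w₀ w₀≤w₁ , c≤w₀)
    where
    c≤w₀ : c ≤ toℕ w₀
    c≤w₀ = ≤-reflexive (sym toℕ-w₀)

  unfixable[B]⇒¬B₀ : Holds w₁ g₁ (subst-p unfixable B) → ¬ Holds w₀ g₀ B
  unfixable[B]⇒¬B₀ holds b₀ =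
    holds (aged 0) (≤⇒≤ᵇ (aged-∈ 0)) (≡⇒≡ᵇ 0 _ (sym (age-aged₁ 0)))
      w₀ (<⇒<ᵇ (≤-reflexive (sym w₁≡1+w₀))) (≡⇒≡ᵇ 1 _ (sym (age-aged₀ 0)))
      (transfer B dom₀ (InDomain-≤ w₀≤w₁ (update-InDomain 0 (aged-∈ 0) dom₁)) bisim b₀)
    where
    bisim : Bisim (depth B) w₀ g₀ w₀ (g₁ [ 0 ↦ aged 0 ])
    bisim = update-AgesAgree 0 refl (ages-agree λ u → trans (age-aged₀ 2) (sym (g₁-old-at-w₀ u))) , inj₁ refl

  ¬B₀⇒unfixable[B] : ¬ Holds w₀ g₀ B → Holds w₁ g₁ (subst-p unfixable B)
  ¬B₀⇒unfixable[B] ¬b₀ a a∈w₁ age₀ v v≺w₁ age₁ b =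
    ¬b₀ (transfer B dom dom₀ (ages , inj₁ v≡w₀) b)
    where
    v≤w₁ : toℕ v ≤ toℕ w₁
    v≤w₁ = <⇒≤ (<ᵇ⇒< _ _ v≺w₁)
    a-age₁ : age v a ≡ 1
    a-age₁ = sym (≡ᵇ⇒≡ 1 _ age₁)
    v≡w₀ : toℕ v ≡ toℕ w₀
    v≡w₀ = suc-injective (trans
      (sym (age≡0∧age≡1⇒adjacent v≤w₁ (≤ᵇ⇒≤ _ _ a∈w₁) (sym (≡ᵇ⇒≡ 0 _ age₀)) a-age₁))
      w₁≡1+w₀)
    dom : InDomain v (g₁ [ 0 ↦ a ])
    dom = InDomain-≤ v≤w₁ (update-InDomain 0 (≤ᵇ⇒≤ _ _ a∈w₁) dom₁)
    ages : AgesAgree v (g₁ [ 0 ↦ a ]) w₀ g₀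
    ages = update-AgesAgree 0 (trans a-age₁ (sym (age-aged₀ 0)))
      (ages-agree λ u → trans (cong (λ m → cap (toℕ (g₁ u) ∸ m)) v≡w₀)
                   (trans (g₁-old-at-w₀ u) (sym (age-aged₀ 2))))

  no-fixed-point : ¬ Valid frame (B ⇔ subst-p unfixable B)
  no-fixed-point valid = valid interp w₁ g₁ (λ u → ≤⇒≤ᵇ (dom₁ u)) λ B⇒A A⇒B →
    let ¬b₁ : ¬ Holds w₁ g₁ B
        ¬b₁ b₁ = unfixable[B]⇒¬B₀ (B⇒A b₁) (transfer B dom₁ dom₀ bisim₁₀ b₁)
    in ¬b₁ (A⇒B (¬B₀⇒unfixable[B] (¬b₁ ∘ transfer B dom₀ dom₁ (Bisim-sym bisim₁₀))))

theorem3p6 : ¬ FIFD-FixedPointProperty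
theorem3p6 fixed-point-property =
  let (B , _ , fixed) = fixed-point-property unfixable (tt , tt)
  in Counterexample.no-fixed-point B (fixed _)
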